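{- Let $n>k\geqslant 1$ be integers and $\sigma\in S_n$. If $\sigma$ is $k$-prolific, then $\sigma$ is $j$-prolific for every integer $j$ with $1\leqslant j<k$.
   Context: $S_n$ is the set of permutations of $[n]$, in one-line notation. A permutation $\sigma\in S_n$ contains $\pi\in S_r$ (written $\pi\preceq\sigma$) if there are indices $i_1<\dots<i_r$ with $\sigma(i_1)\cdots\sigma(i_r)$ in the same relative order as $\pi$. For $n>k\geqslant1$, $\sigma\in S_n$ is $k$-prolific if $|\{\pi\in S_{n-k}:\pi\preceq\sigma\}|=\binom{n}{k}$. -}

module Defs where

open import Data.Nat using (ℕ; _+_; _∸_)
open import Data.Nat.Combinatorics using (_C_)
open import Data.Fin using (Fin; _<_)
open import Data.Fin.Permutation using (Permutation′; _⟨$⟩ʳ_; _≈_)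
open import Data.List using (List; length)
open import Data.List.Membership.Propositional using (_∈_)
open import Data.List.Relation.Unary.All using (All)
open import Data.List.Relation.Unary.AllPairs using (AllPairs)
open import Data.Product using (Σ; ∃; _×_)
open import Function.Bundles using (_⇔_)
open import Relation.Nullary using (¬_)

_≼_ : ∀ {r n} → Permutation′ r → Permutation′ n → Set
_≼_ {r} {n} π σ =
  Σ (Fin r → Fin n) λ f →
    (∀ a b → a < b → f a < f b) ×
    (∀ a b → ((σ ⟨$⟩ʳ f a) < (σ ⟨$⟩ʳ f b)) ⇔ ((π ⟨$⟩ʳ a) < (π ⟨$⟩ʳ b)))

-- "The set {π ∈ S_m : π ≼ σ} has exactly c elements": there is a list of
-- permutations of [m], pairwise distinct (as functions), consisting exactly of
-- the patterns of size m contained in σ, of length c.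
PatternCount : ∀ {n} (m : ℕ) → Permutation′ n → ℕ → Set
PatternCount m σ c =
  Σ (List (Permutation′ m)) λ ps →
    AllPairs (λ p q → ¬ (p ≈ q)) ps ×
    All (λ p → p ≼ σ) ps ×
    (∀ (π : Permutation′ m) → π ≼ σ → Σ (Permutation′ m) λ p → (p ∈ ps) × (p ≈ π)) ×
    length ps ≡ c
  where open import Relation.Binary.PropositionalEquality using (_≡_)

Prolific : ∀ {n} (k : ℕ) → Permutation′ n → Set
Prolific {n} k σ = PatternCount (n ∸ k) σ (n C k)

-- Put m = n ∸ k. The m-element index sets θ of σ each carry a pattern, and every
-- pattern of σ of length m arises from one of them; as there are C(n, m) = C(n, k)
-- index sets, σ is k-prolific exactly when distinct index sets carry distinct
-- patterns. That property passes from m to m + 1 (for m ≥ 1): if two (m+1)-sets carry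
-- the same pattern, deleting their first points, and likewise their second points,
-- leaves m-sets with equal patterns, hence equal m-sets, and these two deletions
-- determine the original sets. Since j < k means n ∸ j > n ∸ k ≥ 1, the claim follows.

module Submission where

open import Defs
open import Data.Nat using (ℕ; _≤_; _<_)
open import Data.Fin.Permutation using (Permutation′)

open import Data.Nat using (zero; suc; _∸_; z≤n; s≤s; s<s⁻¹; _≤′_; ≤′-refl; ≤′-reflexive; ≤′-step)
import Data.Nat.Properties as ℕ
open import Data.Nat.Combinatorics using (_C_; nCk≡nC[n∸k]; nCk+nC[k+1]≡[n+1]C[k+1])
open import Data.Fin as F using (Fin; zero; suc; toℕ; fromℕ<; punchIn; punchOut; inject₁)
import Data.Fin.Properties as F
open import Data.Fin.Induction using (<-weakInduction)
open import Data.Fin.Subset using (Subset; _∈_; _⊂_; ∣_∣)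
open import Data.Fin.Subset.Properties using (⊆⊤; ∈⊤; p⊂q⇒∣p∣<∣q∣; ∣⊤∣≡n)
open import Data.Fin.Permutation using (_⟨$⟩ʳ_; _⟨$⟩ˡ_; _≈_; permutation; inverseˡ; inverseʳ)
import Data.Vec as Vec
open import Data.Vec.Properties using (lookup∘tabulate; []=⇒lookup; lookup⇒[]=)
open import Data.List using (List; length; lookup; tabulate)
open import Data.List.Properties using (length-tabulate)
import Data.List.Relation.Unary.All as All
import Data.List.Relation.Unary.All.Properties as All
open import Data.List.Relation.Unary.AllPairs using (AllPairs; _∷_)
import Data.List.Relation.Unary.AllPairs.Properties as AllPairs
open import Data.List.Membership.Propositional using () renaming (_∈_ to _∈ₗ_)
open import Data.List.Membership.Propositional.Properties using (∈-lookup; ∈-tabulate⁺)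
open import Data.Sum using (_⊎_; inj₁; inj₂; [_,_])
open import Data.Sum.Function.Propositional using (_⊎-↔_)
open import Data.Unit using (⊤; tt)
open import Data.Empty using (⊥; ⊥-elim)
open import Data.Product using (Σ; ∃; _×_; _,_; proj₁; proj₂; map₂)
open import Function using (_∘_)
open import Function.Bundles using (_⇔_; _↔_; mk⇔; mk↔ₛ′; Equivalence; Inverse; Injection)
open import Function.Definitions using (Injective)
open import Function.Construct.Symmetry using (⇔-sym)
open import Function.Construct.Composition using (_⇔-∘_)
open import Function.Properties.Inverse using (↔-sym; ↔-trans; ↔⇒↣)
open import Relation.Binary.Definitions using (Symmetric; tri<; tri≈; tri>)
open import Relation.Binary.PropositionalEquality
  using (_≡_; _≢_; _≗_; refl; sym; trans; cong; subst; subst₂; module ≡-Reasoning)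
open import Relation.Nullary using (¬_; yes; no; does; contradiction)
open import Relation.Nullary.Decidable using (dec-true)
open import Relation.Unary using (Pred; Decidable)

Increasing : ∀ {m n} → (Fin m → Fin n) → Set
Increasing f = ∀ a b → a F.< b → f a F.< f b

SameOrder : ∀ {m n o} → (Fin m → Fin n) → (Fin m → Fin o) → Set
SameOrder g h = ∀ a b → (g a F.< g b) ⇔ (h a F.< h b)

sameOrder-sym : ∀ {m n o} {f : Fin m → Fin n} {g : Fin m → Fin o} →
  SameOrder f g → SameOrder g f
sameOrder-sym f~g a b = ⇔-sym (f~g a b)

sameOrder-trans : ∀ {m n o p} {f : Fin m → Fin n} {g : Fin m → Fin o} {h : Fin m → Fin p} →
  SameOrder f g → SameOrder g h → SameOrder f h
sameOrder-trans f~g g~h a b = g~h a b ⇔-∘ f~g a b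

≗⇒sameOrder : ∀ {m n} {f g : Fin m → Fin n} → f ≗ g → SameOrder f g
≗⇒sameOrder f≗g a b = mk⇔ (subst₂ F._<_ (f≗g a) (f≗g b)) (subst₂ F._<_ (sym (f≗g a)) (sym (f≗g b)))

preserves⇒sameOrder : ∀ {m n o} {g : Fin m → Fin n} {h : Fin m → Fin o} →
  Injective _≡_ _≡_ g → (∀ a b → g a F.< g b → h a F.< h b) → SameOrder g h
preserves⇒sameOrder {g = g} {h} g-injective preserves a b = mk⇔ (preserves a b) reflects
  where
  reflects : h a F.< h b → g a F.< g b
  reflects ha<hb with F.<-cmp (g a) (g b)
  ... | tri< ga<gb _ _ = ga<gb
  ... | tri≈ _ ga≡gb _ rewrite g-injective ga≡gb = contradiction ha<hb (F.<-irrefl refl)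
  ... | tri> _ _ gb<ga = contradiction ha<hb (F.<-asym (preserves b a gb<ga))

preserves⇒injective : ∀ {m n o} {g : Fin m → Fin n} {h : Fin m → Fin o} →
  Injective _≡_ _≡_ g → (∀ a b → g a F.< g b → h a F.< h b) → Injective _≡_ _≡_ h
preserves⇒injective {g = g} g-injective preserves {a} {b} ha≡hb with F.<-cmp (g a) (g b)
... | tri< ga<gb _ _ = contradiction ha≡hb (F.<⇒≢ (preserves a b ga<gb))
... | tri≈ _ ga≡gb _ = g-injective ga≡gb
... | tri> _ _ gb<ga = contradiction (sym ha≡hb) (F.<⇒≢ (preserves b a gb<ga))

increasing⇒inflationary : ∀ {m n} {f : Fin (suc m) → Fin n} → Increasing f → ∀ x → toℕ x ≤ toℕ (f x)
increasing⇒inflationary {f = f} f-increasing = <-weakInduction (λ x → toℕ x ≤ toℕ (f x)) z≤n step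
  where
  step : ∀ i → toℕ (inject₁ i) ≤ toℕ (f (inject₁ i)) → suc (toℕ i) ≤ toℕ (f (suc i))
  step i ih = ℕ.≤-<-trans (subst (_≤ toℕ (f (inject₁ i))) (F.toℕ-inject₁ i) ih)
                          (f-increasing (inject₁ i) (suc i) (F.≤̄⇒inject₁< ℕ.≤-refl))

-- x ≤ f x ≤ g (f x) = x.
increasing-section⇒id : ∀ {m} {f g : Fin m → Fin m} → Increasing f → Increasing g →
  (∀ x → g (f x) ≡ x) → ∀ x → f x ≡ x
increasing-section⇒id {zero} _ _ _ ()
increasing-section⇒id {suc m} {f} {g} f-increasing g-increasing gf≡id x =
  F.toℕ-injective (ℕ.≤-antisym
    (subst (toℕ (f x) ≤_) (cong toℕ (gf≡id x)) (increasing⇒inflationary g-increasing (f x)))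
    (increasing⇒inflationary f-increasing x))

sameOrder⇒≈ : ∀ {m} (π ρ : Permutation′ m) → SameOrder (π ⟨$⟩ʳ_) (ρ ⟨$⟩ʳ_) → π ≈ ρ
sameOrder⇒≈ π ρ π~ρ a = trans (sym (ρπ⁻¹≡id (π ⟨$⟩ʳ a))) (cong (ρ ⟨$⟩ʳ_) (inverseˡ π))
  where
  transfer : ∀ (α β : Permutation′ _) → SameOrder (α ⟨$⟩ʳ_) (β ⟨$⟩ʳ_) →
             Increasing (λ x → β ⟨$⟩ʳ (α ⟨$⟩ˡ x))
  transfer α β α~β x y x<y =
    Equivalence.to (α~β _ _) (subst₂ F._<_ (sym (inverseʳ α {x})) (sym (inverseʳ α {y})) x<y)
  ρπ⁻¹≡id : ∀ x → ρ ⟨$⟩ʳ (π ⟨$⟩ˡ x) ≡ x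
  ρπ⁻¹≡id = increasing-section⇒id (transfer π ρ π~ρ) (transfer ρ π (sameOrder-sym π~ρ))
    (λ x → trans (cong (π ⟨$⟩ʳ_) (inverseˡ ρ {π ⟨$⟩ˡ x})) (inverseʳ π))

injective⇒surjective : ∀ {m} {f : Fin m → Fin m} → Injective _≡_ _≡_ f → ∀ y → ∃ λ x → f x ≡ y
injective⇒surjective {zero} _ ()
injective⇒surjective {suc m} {f} f-injective y with F.any? (λ x → f x F.≟ y)
... | yes hit = hit
... | no miss = contradiction (F.injective⇒≤ punchOut∘f-injective) ℕ.1+n≰n
  where
  y≢f : ∀ x → y ≢ f x
  y≢f x y≡fx = miss (x , sym y≡fx)
  punchOut∘f-injective : Injective _≡_ _≡_ (λ x → punchOut (y≢f x))
  punchOut∘f-injective eq = f-injective (F.punchOut-injective (y≢f _) (y≢f _) eq)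

injective⇒permutation : ∀ {m} (f : Fin m → Fin m) → Injective _≡_ _≡_ f → Permutation′ m
injective⇒permutation f f-injective = permutation f
  (λ y → proj₁ (injective⇒surjective f-injective y))
  (λ y → proj₂ (injective⇒surjective f-injective y))
  (λ x → f-injective (proj₂ (injective⇒surjective f-injective (f x))))

↔-injective⇒surjective : ∀ {c} {A : Set} → Fin c ↔ A → (h : Fin c → A) → Injective _≡_ _≡_ h →
  ∀ a → ∃ λ i → h i ≡ a
↔-injective⇒surjective e h h-injective a =
  map₂ from-injective (injective⇒surjective (h-injective ∘ from-injective) (Inverse.from e a))
  where
  from-injective : Injective _≡_ _≡_ (Inverse.from e)
  from-injective = Injection.injective (↔⇒↣ (↔-sym e))

select : ∀ {m p} {P : Pred (Fin m) p} → Decidable P → Subset m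
select P? = Vec.tabulate (does ∘ P?)

module _ {m p} {P : Pred (Fin m) p} (P? : Decidable P) where

  ∈-select⁺ : ∀ {x} → P x → x ∈ select P?
  ∈-select⁺ {x} px = lookup⇒[]= x (select P?) (trans (lookup∘tabulate _ x) (dec-true (P? x) px))

  ∈-select⁻ : ∀ {x} → x ∈ select P? → P x
  ∈-select⁻ {x} x∈ with P? x | trans (sym (lookup∘tabulate (does ∘ P?) x)) ([]=⇒lookup x∈)
  ... | yes px | _ = px
  ... | no _ | ()

module Rank {m n} (g : Fin m → Fin n) where

  smaller? : ∀ a → Decidable (λ b → g b F.< g a)
  smaller? a b = g b F.<? g a

  below : Fin m → Subset m
  below a = select (smaller? a)

  below-⊂ : ∀ {a b} → g a F.< g b → below a ⊂ below b
  below-⊂ {a} {b} ga<gb =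
    (λ c∈ → ∈-select⁺ (smaller? b) (F.<-trans (∈-select⁻ (smaller? a) c∈) ga<gb)) ,
    a , ∈-select⁺ (smaller? b) ga<gb , λ a∈ → F.<-irrefl refl (∈-select⁻ (smaller? a) a∈)

  ∣below∣<m : ∀ a → ∣ below a ∣ < m
  ∣below∣<m a = subst (∣ below a ∣ <_) (∣⊤∣≡n m)
    (p⊂q⇒∣p∣<∣q∣ (⊆⊤ , a , ∈⊤ , λ a∈ → F.<-irrefl refl (∈-select⁻ (smaller? a) a∈)))

  rank : Fin m → Fin m
  rank a = fromℕ< (∣below∣<m a)

  rank-preserves : ∀ a b → g a F.< g b → rank a F.< rank b
  rank-preserves a b ga<gb =
    subst₂ _<_ (sym (F.toℕ-fromℕ< (∣below∣<m a))) (sym (F.toℕ-fromℕ< (∣below∣<m b)))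
      (p⊂q⇒∣p∣<∣q∣ (below-⊂ ga<gb))

standardise : ∀ {m n} (g : Fin m → Fin n) → Injective _≡_ _≡_ g → Permutation′ m
standardise g g-injective = injective⇒permutation rank (preserves⇒injective g-injective rank-preserves)
  where open Rank g

standardise-sameOrder : ∀ {m n} (g : Fin m → Fin n) (g-injective : Injective _≡_ _≡_ g) →
  SameOrder g (standardise g g-injective ⟨$⟩ʳ_)
standardise-sameOrder g g-injective = preserves⇒sameOrder g-injective rank-preserves
  where open Rank g

-- Thinnings: m ⊑ n encodes an order-preserving embedding Fin m → Fin n, i.e. an m-subset of Fin n

infix 4 _⊑_

data _⊑_ : ℕ → ℕ → Set where
  done : 0 ⊑ 0
  keep : ∀ {m n} → m ⊑ n → suc m ⊑ suc n
  drop : ∀ {m n} → m ⊑ n → m ⊑ suc n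

embed : ∀ {m n} → m ⊑ n → Fin m → Fin n
embed (keep θ) zero = zero
embed (keep θ) (suc a) = suc (embed θ a)
embed (drop θ) a = suc (embed θ a)

embed-increasing : ∀ {m n} (θ : m ⊑ n) → Increasing (embed θ)
embed-increasing (keep θ) zero (suc b) _ = s≤s z≤n
embed-increasing (keep θ) (suc a) (suc b) (s≤s a<b) = s≤s (embed-increasing θ a b a<b)
embed-increasing (drop θ) a b a<b = s≤s (embed-increasing θ a b a<b)

empty : ∀ n → 0 ⊑ n
empty zero = done
empty (suc n) = drop (empty n)

empty-unique : ∀ {n} (θ : 0 ⊑ n) → θ ≡ empty n
empty-unique done = refl
empty-unique (drop θ) = cong drop (empty-unique θ)

pred⁺ : ∀ {n} (x : Fin (suc n)) → 0 < toℕ x → Fin n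
pred⁺ (suc x) _ = x

suc-pred⁺ : ∀ {n} (x : Fin (suc n)) (0<x : 0 < toℕ x) → suc (pred⁺ x 0<x) ≡ x
suc-pred⁺ (suc x) _ = refl

pred⁺-mono : ∀ {n} {x y : Fin (suc n)} (0<x : 0 < toℕ x) (0<y : 0 < toℕ y) →
  x F.< y → pred⁺ x 0<x F.< pred⁺ y 0<y
pred⁺-mono {x = suc x} {suc y} _ _ x<y = s<s⁻¹ x<y

increasing⇒thinning : ∀ {m n} (f : Fin m → Fin n) → Increasing f →
  Σ (m ⊑ n) λ θ → embed θ ≗ f
increasing⇒thinning {zero} {n} f _ = empty n , λ ()
increasing⇒thinning {suc m} {zero} f _ = ⊥-elim (F.¬Fin0 (f zero))
increasing⇒thinning {suc m} {suc n} f f-increasing with f zero in f0≡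
... | zero = keep θ , embed≗f
  where
  0<f∘suc : ∀ a → 0 < toℕ (f (suc a))
  0<f∘suc a = subst (F._< f (suc a)) f0≡ (f-increasing zero (suc a) (s≤s z≤n))
  g : Fin m → Fin n
  g a = pred⁺ (f (suc a)) (0<f∘suc a)
  g-thinning : Σ (m ⊑ n) λ θ → embed θ ≗ g
  g-thinning = increasing⇒thinning g λ a b a<b →
    pred⁺-mono _ _ (f-increasing (suc a) (suc b) (s≤s a<b))
  θ : m ⊑ n
  θ = proj₁ g-thinning
  embed≗f : embed (keep θ) ≗ f
  embed≗f zero = sym f0≡
  embed≗f (suc a) = trans (cong suc (proj₂ g-thinning a)) (suc-pred⁺ (f (suc a)) (0<f∘suc a))
... | suc y = drop θ , embed≗f
  where
  0<f : ∀ a → 0 < toℕ (f a)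
  0<f zero rewrite f0≡ = s≤s z≤n
  0<f (suc a) = F.<-trans (0<f zero) (f-increasing zero (suc a) (s≤s z≤n))
  g : Fin (suc m) → Fin n
  g a = pred⁺ (f a) (0<f a)
  g-thinning : Σ (suc m ⊑ n) λ θ → embed θ ≗ g
  g-thinning = increasing⇒thinning g λ a b a<b → pred⁺-mono _ _ (f-increasing a b a<b)
  θ : suc m ⊑ n
  θ = proj₁ g-thinning
  embed≗f : embed (drop θ) ≗ f
  embed≗f a = trans (cong suc (proj₂ g-thinning a)) (suc-pred⁺ (f a) (0<f a))

delete : ∀ {m n} → suc m ⊑ n → Fin (suc m) → m ⊑ n
delete (drop θ) i = drop (delete θ i)
delete (keep θ) zero = drop θ
delete {suc m} (keep θ) (suc i) = keep (delete θ i)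

embed-delete : ∀ {m n} (θ : suc m ⊑ n) i a → embed (delete θ i) a ≡ embed θ (punchIn i a)
embed-delete (drop θ) i a = cong suc (embed-delete θ i a)
embed-delete (keep θ) zero a = refl
embed-delete {suc m} (keep θ) (suc i) zero = refl
embed-delete {suc m} (keep θ) (suc i) (suc a) = cong suc (embed-delete θ i a)

drop-injective : ∀ {m n} {θ θ′ : m ⊑ n} → drop θ ≡ drop θ′ → θ ≡ θ′
drop-injective refl = refl

-- Deleting the first point determines all other points; deleting the second determines the first.
delete₀₁-injective : ∀ {m n} (θ θ′ : suc (suc m) ⊑ n) →
  delete θ zero ≡ delete θ′ zero → delete θ (suc zero) ≡ delete θ′ (suc zero) → θ ≡ θ′
delete₀₁-injective (drop θ) (drop θ′) eq₀ eq₁ =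
  cong drop (delete₀₁-injective θ θ′ (drop-injective eq₀) (drop-injective eq₁))
delete₀₁-injective (keep θ) (keep θ′) eq₀ _ = cong keep (drop-injective eq₀)
delete₀₁-injective (keep θ) (drop θ′) _ ()
delete₀₁-injective (drop θ) (keep θ′) _ ()

sameOrder-delete : ∀ {m n o} (g : Fin n → Fin o) (θ θ′ : suc m ⊑ n) i →
  SameOrder (g ∘ embed θ) (g ∘ embed θ′) → SameOrder (g ∘ embed (delete θ i)) (g ∘ embed (delete θ′ i))
sameOrder-delete g θ θ′ i θ~θ′ a b
  rewrite embed-delete θ i a | embed-delete θ i b | embed-delete θ′ i a | embed-delete θ′ i b =
  θ~θ′ (F.punchIn i a) (F.punchIn i b)

0⊑↔⊤ : ∀ n → (0 ⊑ n) ↔ ⊤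
0⊑↔⊤ n = mk↔ₛ′ (λ _ → tt) (λ _ → empty n) (λ _ → refl) (λ θ → sym (empty-unique θ))

suc⊑0↔⊥ : ∀ m → (suc m ⊑ 0) ↔ ⊥
suc⊑0↔⊥ m = mk↔ₛ′ (λ ()) (λ ()) (λ ()) (λ ())

keep⊎drop↔ : ∀ {m n} → (m ⊑ n ⊎ suc m ⊑ n) ↔ (suc m ⊑ suc n)
keep⊎drop↔ = mk↔ₛ′ [ keep , drop ] split
  (λ { (keep θ) → refl ; (drop θ) → refl })
  (λ { (inj₁ θ) → refl ; (inj₂ θ) → refl })
  where
  split : ∀ {m n} → suc m ⊑ suc n → m ⊑ n ⊎ suc m ⊑ n
  split (keep θ) = inj₁ θ
  split (drop θ) = inj₂ θ

Fin[nCm]↔⊑ : ∀ m n → Fin (n C m) ↔ (m ⊑ n)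
Fin[nCm]↔⊑ zero n = ↔-trans F.1↔⊤ (↔-sym (0⊑↔⊤ n))
Fin[nCm]↔⊑ (suc m) zero = ↔-trans F.0↔⊥ (↔-sym (suc⊑0↔⊥ m))
Fin[nCm]↔⊑ (suc m) (suc n) =
  subst (λ c → Fin c ↔ (suc m ⊑ suc n)) (nCk+nC[k+1]≡[n+1]C[k+1] n m)
    (↔-trans F.+↔⊎ (↔-trans (Fin[nCm]↔⊑ m n ⊎-↔ Fin[nCm]↔⊑ (suc m) n) keep⊎drop↔))

AllPairs-lookup : ∀ {a r} {A : Set a} {R : A → A → Set r} → Symmetric R →
  ∀ {xs} → AllPairs R xs → ∀ {i j} → i ≢ j → R (lookup xs i) (lookup xs j)
AllPairs-lookup R-sym (_ ∷ _) {zero} {zero} i≢j = contradiction refl i≢j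
AllPairs-lookup R-sym (Rx ∷ _) {zero} {suc j} _ = All.lookup Rx (∈-lookup j)
AllPairs-lookup R-sym (Rx ∷ _) {suc i} {zero} _ = R-sym (All.lookup Rx (∈-lookup i))
AllPairs-lookup R-sym (_ ∷ R-xs) {suc i} {suc j} i≢j = AllPairs-lookup R-sym R-xs (i≢j ∘ cong suc)

sameOrder-lookup-injective : ∀ {m} {ps : List (Permutation′ m)} → AllPairs (λ p q → ¬ p ≈ q) ps →
  ∀ {i j} → SameOrder (lookup ps i ⟨$⟩ʳ_) (lookup ps j ⟨$⟩ʳ_) → i ≡ j
sameOrder-lookup-injective {ps = ps} ps-distinct {i} {j} pᵢ~pⱼ with i F.≟ j
... | yes i≡j = i≡j
... | no i≢j = contradiction (sameOrder⇒≈ (lookup ps i) (lookup ps j) pᵢ~pⱼ)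
                 (AllPairs-lookup (λ p≉q q≈p → p≉q (sym ∘ q≈p)) ps-distinct i≢j)

module Patterns {n} (σ : Permutation′ n) where

  σ-injective : Injective _≡_ _≡_ (σ ⟨$⟩ʳ_)
  σ-injective = Injection.injective (↔⇒↣ σ)

  σ∣ : ∀ {m} → m ⊑ n → Fin m → Fin n
  σ∣ θ a = σ ⟨$⟩ʳ embed θ a

  σ∣-injective : ∀ {m} (θ : m ⊑ n) → Injective _≡_ _≡_ (σ∣ θ)
  σ∣-injective θ = preserves⇒injective (λ eq → eq) (embed-increasing θ) ∘ σ-injective

  patternAt : ∀ {m} → m ⊑ n → Permutation′ m
  patternAt θ = standardise (σ∣ θ) (σ∣-injective θ)

  patternAt-sameOrder : ∀ {m} (θ : m ⊑ n) → SameOrder (σ∣ θ) (patternAt θ ⟨$⟩ʳ_)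
  patternAt-sameOrder θ = standardise-sameOrder (σ∣ θ) (σ∣-injective θ)

  patternAt-≼ : ∀ {m} (θ : m ⊑ n) → patternAt θ ≼ σ
  patternAt-≼ θ = embed θ , embed-increasing θ , patternAt-sameOrder θ

  ≼⇒occurrence : ∀ {m} (π : Permutation′ m) → π ≼ σ →
    Σ (m ⊑ n) λ θ → SameOrder (σ∣ θ) (π ⟨$⟩ʳ_)
  ≼⇒occurrence π (f , f-increasing , σf~π)
    with θ , embed≗f ← increasing⇒thinning f f-increasing =
    θ , sameOrder-trans (≗⇒sameOrder (cong (σ ⟨$⟩ʳ_) ∘ embed≗f)) σf~π

  patternAt-≈⇒sameOrder : ∀ {m} (θ θ′ : m ⊑ n) →
    patternAt θ ≈ patternAt θ′ → SameOrder (σ∣ θ) (σ∣ θ′)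
  patternAt-≈⇒sameOrder θ θ′ eq = sameOrder-trans (patternAt-sameOrder θ)
    (sameOrder-trans (≗⇒sameOrder eq) (sameOrder-sym (patternAt-sameOrder θ′)))

  DistinctPatterns : ℕ → Set
  DistinctPatterns m = ∀ (θ θ′ : m ⊑ n) → SameOrder (σ∣ θ) (σ∣ θ′) → θ ≡ θ′

  distinctPatterns-suc : ∀ {m} → DistinctPatterns (suc m) → DistinctPatterns (suc (suc m))
  distinctPatterns-suc distinct θ θ′ θ~θ′ = delete₀₁-injective θ θ′
    (distinct _ _ (sameOrder-delete (σ ⟨$⟩ʳ_) θ θ′ zero θ~θ′))
    (distinct _ _ (sameOrder-delete (σ ⟨$⟩ʳ_) θ θ′ (suc zero) θ~θ′))

  distinctPatterns-mono : ∀ {a b} → 1 ≤ a → a ≤ b → DistinctPatterns a → DistinctPatterns b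
  distinctPatterns-mono {suc a} _ a≤b = go (ℕ.≤⇒≤′ a≤b)
    where
    go : ∀ {b} → suc a ≤′ b → DistinctPatterns (suc a) → DistinctPatterns b
    go ≤′-refl distinct = distinct
    go (≤′-step {zero} (≤′-reflexive ())) _
    go (≤′-step {suc b} a≤b) distinct = distinctPatterns-suc (go a≤b distinct)

  distinctPatterns⇒count : ∀ {m} → DistinctPatterns m → PatternCount m σ (n C m)
  distinctPatterns⇒count {m} distinct =
    ps , ps-distinct , All.tabulate⁺ (patternAt-≼ ∘ thinning) , ps-complete , length-tabulate _
    where
    thinning : Fin (n C m) → m ⊑ n
    thinning = Inverse.to (Fin[nCm]↔⊑ m n)
    ps : List (Permutation′ m)
    ps = tabulate (patternAt ∘ thinning)
    ps-distinct : AllPairs (λ p q → ¬ p ≈ q) ps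
    ps-distinct = AllPairs.tabulate⁺ {f = patternAt ∘ thinning} λ i≢j eq →
      i≢j (Injection.injective (↔⇒↣ (Fin[nCm]↔⊑ m n)) (distinct _ _ (patternAt-≈⇒sameOrder _ _ eq)))
    patternAt∈ps : ∀ θ → patternAt θ ∈ₗ ps
    patternAt∈ps θ = subst (λ θ → patternAt θ ∈ₗ ps) (Inverse.strictlyInverseˡ (Fin[nCm]↔⊑ m n) θ)
      (∈-tabulate⁺ {f = patternAt ∘ thinning} (Inverse.from (Fin[nCm]↔⊑ m n) θ))
    ps-complete : ∀ π → π ≼ σ → Σ (Permutation′ m) λ p → (p ∈ₗ ps) × (p ≈ π)
    ps-complete π π≼σ with θ , θ~π ← ≼⇒occurrence π π≼σ =
      patternAt θ , patternAt∈ps θ ,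
      sameOrder⇒≈ (patternAt θ) π (sameOrder-trans (sameOrder-sym (patternAt-sameOrder θ)) θ~π)

  -- An occurrence of each listed pattern gives an injection from the C(n, m) list
  -- positions into the C(n, m) thinnings, which is then onto.
  count⇒distinctPatterns : ∀ {m} → PatternCount m σ (n C m) → DistinctPatterns m
  count⇒distinctPatterns {m} (ps , ps-distinct , ps≼σ , _ , length≡) θ θ′ θ~θ′ = begin
    θ              ≡⟨ sym (proj₂ (hit θ)) ⟩
    occurrence i   ≡⟨ cong occurrence (occurrence-sameOrder-injective θᵢ~θⱼ) ⟩
    occurrence j   ≡⟨ proj₂ (hit θ′) ⟩
    θ′             ∎
    where
    open ≡-Reasoning
    occurrence-of : ∀ i → Σ (m ⊑ n) λ θ → SameOrder (σ∣ θ) (lookup ps i ⟨$⟩ʳ_)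
    occurrence-of i = ≼⇒occurrence (lookup ps i) (All.lookup ps≼σ (∈-lookup i))
    occurrence : Fin (length ps) → m ⊑ n
    occurrence i = proj₁ (occurrence-of i)
    occurrence-sameOrder-injective : ∀ {i j} → SameOrder (σ∣ (occurrence i)) (σ∣ (occurrence j)) → i ≡ j
    occurrence-sameOrder-injective {i} {j} θᵢ~θⱼ = sameOrder-lookup-injective ps-distinct
      (sameOrder-trans (sameOrder-sym (proj₂ (occurrence-of i)))
        (sameOrder-trans θᵢ~θⱼ (proj₂ (occurrence-of j))))
    occurrence-injective : Injective _≡_ _≡_ occurrence
    occurrence-injective θᵢ≡θⱼ = occurrence-sameOrder-injective (≗⇒sameOrder (λ a → cong (λ θ → σ∣ θ a) θᵢ≡θⱼ))
    hit : ∀ θ → ∃ λ i → occurrence i ≡ θ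
    hit = ↔-injective⇒surjective
      (subst (λ c → Fin c ↔ (m ⊑ n)) (sym length≡) (Fin[nCm]↔⊑ m n)) occurrence occurrence-injective
    i j : Fin (length ps)
    i = proj₁ (hit θ)
    j = proj₁ (hit θ′)
    θᵢ~θⱼ : SameOrder (σ∣ (occurrence i)) (σ∣ (occurrence j))
    θᵢ~θⱼ = subst₂ (λ θ θ′ → SameOrder (σ∣ θ) (σ∣ θ′))
      (sym (proj₂ (hit θ))) (sym (proj₂ (hit θ′))) θ~θ′

  prolific⇔distinctPatterns : ∀ {k} → k ≤ n → Prolific k σ ⇔ DistinctPatterns (n ∸ k)
  prolific⇔distinctPatterns {k} k≤n = mk⇔
    (count⇒distinctPatterns ∘ subst (PatternCount (n ∸ k) σ) (nCk≡nC[n∸k] k≤n))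
    (subst (PatternCount (n ∸ k) σ) (sym (nCk≡nC[n∸k] k≤n)) ∘ distinctPatterns⇒count)

corollary2p26 : (n k : ℕ) → 1 ≤ k → k < n → (σ : Permutation′ n) →
    Prolific k σ → (j : ℕ) → 1 ≤ j → j < k → Prolific j σ
corollary2p26 n k _ k<n σ k-prolific j _ j<k =
  Equivalence.from (prolific⇔distinctPatterns (ℕ.<⇒≤ (ℕ.<-trans j<k k<n)))
    (distinctPatterns-mono (ℕ.m<n⇒0<n∸m k<n) (ℕ.∸-monoʳ-≤ n (ℕ.<⇒≤ j<k))
      (Equivalence.to (prolific⇔distinctPatterns (ℕ.<⇒≤ k<n)) k-prolific))
  where open Patterns σ
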